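{- For every system $T\subseteq\{x_i+1=x_k,\ x_i\cdot x_j=x_k:\ i,j,k\in\{1,2,3\}\}$ which has only finitely many solutions in positive integers $x_1,x_2,x_3$, each such solution satisfies $x_1,x_2,x_3\leqslant f(3)=4$.
   Context: Here $f(3)=2^{2^{1}}=4$, the value at $n=3$ of the function $f$ with $f(1)=1$, $f(n)=2^{2^{n-2}}$ for $n\in\{2,3,4,5\}$, $f(n)=\left(2+2^{2^{n-4}}\right)^{2^{n-4}}$ for $n\geqslant6$. -}

module Defs where

open import Data.Nat using (ℕ; suc; _+_; _*_; _≤_; _<_)
open import Data.Fin using (Fin)
open import Data.List using (List)
open import Data.List.Relation.Unary.All using (All)
open import Data.List.Membership.Propositional using (_∈_)
open import Data.Product using (∃-syntax; _×_)
open import Data.List.Relation.Unary.Any using (Any)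
open import Relation.Binary.PropositionalEquality using (_≡_)

-- Equations over the variables x₁,…,xₙ (indices are Fin n; Fin 3 ≅ {1,2,3}).
--   addOne i k  denotes  x_i + 1 = x_k
--   mul i j k   denotes  x_i · x_j = x_k
data Equation (n : ℕ) : Set where
  addOne : Fin n → Fin n → Equation n
  mul    : Fin n → Fin n → Fin n → Equation n

Assignment : ℕ → Set
Assignment n = Fin n → ℕ

Holds : ∀ {n} → Assignment n → Equation n → Set
Holds x (addOne i k) = x i + 1 ≡ x k
Holds x (mul i j k)  = x i * x j ≡ x k

System : ℕ → Set
System n = List (Equation n)

PosSolution : ∀ {n} → System n → Assignment n → Set
PosSolution {n} T x = (∀ (i : Fin n) → 1 ≤ x i) × All (Holds x) T

FinitelyManyPosSolutions : ∀ {n} → System n → Set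
FinitelyManyPosSolutions {n} T =
  ∃[ L ] (∀ (x : Assignment n) → PosSolution T x →
            Any {A = Assignment n} (λ y → ∀ i → x i ≡ y i) L)

{-# OPTIONS --safe #-}
module Submission where

open import Defs
open import Data.Empty using (⊥-elim)
open import Data.Fin using (Fin; inject₁)
open import Data.Fin.Patterns using (0F; 1F; 2F)
open import Data.List using (List; map)
open import Data.List.Extrema.Nat using (max; v≤max⁺)
import Data.List.Relation.Unary.All as All
open import Data.List.Relation.Unary.Any as Any using (Any)
open import Data.List.Relation.Unary.Any.Properties using (map⁺)
open import Data.Nat
open import Data.Nat.Properties
open import Data.Product using (∃-syntax; _×_; _,_)
open import Data.Sum using (inj₂)
open import Function using (_∘_; id)
open import Relation.Binary.PropositionalEquality
open import Relation.Binary.Definitions using (tri<; tri≈; tri>)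
open import Relation.Nullary using (yes; no)

-- Suppose some xᵢ ≥ 5 and let 1 ≤ a < b < c be the values of x, padded to three. We replace
-- them by positive a′, b′, c′, as large as we like wherever the old value is ≥ 5, such that every
-- equation u + 1 = v or u · v = w holding among a, b, c also holds among a′, b′, c′; composing x
-- with this substitution preserves every equation of T, so T has arbitrarily large solutions.
-- For a = 1 keep a′ = 1 (and b′ = 2 if b = 2); for a ≥ 2 take a′ = N large. Each later value is
-- sent to N + 1, N², b′ + 1, N · b′, b′², … according to the relation tying it to the smaller
-- ones, or to a large fresh value if there is none. The bound 5 excludes (2, 3, 4), where
-- 2 + 1 = 3, 3 + 1 = 4 and 2 · 2 = 4 cannot be lifted simultaneously.

m*n≡n⇒m≡1 : ∀ {m n} → 1 ≤ n → m * n ≡ n → m ≡ 1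
m*n≡n⇒m≡1 {m} {n} 1≤n eq = *-cancelʳ-≡ m 1 n {{>-nonZero 1≤n}} (trans eq (sym (*-identityˡ n)))

m*n≡m⇒n≡1 : ∀ {m n} → 1 ≤ m → m * n ≡ m → n ≡ 1
m*n≡m⇒n≡1 {m} {n} 1≤m eq = m*n≡n⇒m≡1 1≤m (trans (*-comm n m) eq)

o<n⇒m*n≢o : ∀ {m n o} → 1 ≤ m → o < n → m * n ≢ o
o<n⇒m*n≢o {m} {n} 1≤m o<n = >⇒≢ (<-≤-trans o<n (m≤n*m n m {{>-nonZero 1≤m}}))

o<m⇒m*n≢o : ∀ {m n o} → 1 ≤ n → o < m → m * n ≢ o
o<m⇒m*n≢o {m} {n} 1≤n o<m = >⇒≢ (<-≤-trans o<m (m≤m*n m n {{>-nonZero 1≤n}}))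

m≤n⇒n+1≢m : ∀ {m n} → m ≤ n → n + 1 ≢ m
m≤n⇒n+1≢m {m} {n} m≤n = >⇒≢ (≤-<-trans m≤n (m<m+n n {1} z<s))

n+1<m*n : ∀ {m n} → 2 ≤ m → 2 ≤ n → n + 1 < m * n
n+1<m*n {m} {n} 2≤m 2≤n = begin-strict
  n + 1        <⟨ +-monoʳ-< n (≤-trans 2≤n (≤-reflexive (sym (+-identityʳ n)))) ⟩
  n + (n + 0)  ≤⟨ *-monoˡ-≤ n 2≤m ⟩
  m * n        ∎
  where open ≤-Reasoning

m*m≡m+1+1⇒m≡2 : ∀ m → m * m ≡ m + 1 + 1 → m ≡ 2
m*m≡m+1+1⇒m≡2 0 ()
m*m≡m+1+1⇒m≡2 1 ()
m*m≡m+1+1⇒m≡2 2 _ = refl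
m*m≡m+1+1⇒m≡2 m@(suc (suc (suc k))) eq = ⊥-elim (<⇒≢ m+1+1<m*m (sym eq))
  where
    open ≤-Reasoning
    m+1+1<m*m : m + 1 + 1 < m * m
    m+1+1<m*m = begin-strict
      m + 1 + 1        ≡⟨ +-assoc m 1 1 ⟩
      m + 2            <⟨ +-monoʳ-< m (s≤s (s≤s (s≤s z≤n))) ⟩
      m + 3            ≤⟨ +-monoʳ-≤ m (≤-trans (s≤s (s≤s (s≤s z≤n))) (m≤m+n m (m + 0))) ⟩
      m + (m + (m + 0)) ≤⟨ *-monoˡ-≤ m {3} {m} (s≤s (s≤s (s≤s z≤n))) ⟩
      m * m            ∎

infix 4 _⊑_

_⊑_ : ∀ {n} → Assignment n → Assignment n → Set
x ⊑ y = ∀ e → Holds x e → Holds y e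

⊑-trans : ∀ {n} {x y z : Assignment n} → x ⊑ y → y ⊑ z → x ⊑ z
⊑-trans x⊑y y⊑z e = y⊑z e ∘ x⊑y e

≗⇒⊑ : ∀ {n} {x y : Assignment n} → x ≗ y → x ⊑ y
≗⇒⊑ x≗y (addOne i k) h = subst₂ (λ u v → u + 1 ≡ v) (x≗y i) (x≗y k) h
≗⇒⊑ x≗y (mul i j k)  h = subst₂ _≡_ (cong₂ _*_ (x≗y i) (x≗y j)) (x≗y k) h

∘-⊑ : ∀ {m n} {x y : Assignment n} (σ : Fin m → Fin n) → x ⊑ y → x ∘ σ ⊑ y ∘ σ
∘-⊑ σ x⊑y (addOne i k) = x⊑y (addOne (σ i) (σ k))
∘-⊑ σ x⊑y (mul i j k)  = x⊑y (mul (σ i) (σ j) (σ k))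

⊑-PosSolution : ∀ {n} {T : System n} {x y} → x ⊑ y → (∀ i → 1 ≤ y i) → PosSolution T x → PosSolution T y
⊑-PosSolution x⊑y pos (_ , holds) = pos , All.map (x⊑y _) holds

triple : ℕ → ℕ → ℕ → Assignment 3
triple a b c 0F = a
triple a b c 1F = b
triple a b c 2F = c

-- For 1 ≤ a < b < c these are all the relations among a, b, c except those of the form 1 · u = u.
record PreservesRelations (a b c a′ b′ c′ : ℕ) : Set where
  field
    unit    : a ≡ 1 → a′ ≡ 1
    suc-ab  : a + 1 ≡ b → a′ + 1 ≡ b′
    suc-bc  : b + 1 ≡ c → b′ + 1 ≡ c′
    sq-ab   : a * a ≡ b → a′ * a′ ≡ b′
    sq-ac   : a * a ≡ c → a′ * a′ ≡ c′
    mul-abc : a * b ≡ c → a′ * b′ ≡ c′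
    sq-bc   : b * b ≡ c → b′ * b′ ≡ c′

module _ {a b c a′ b′ c′ : ℕ} (1≤a : 1 ≤ a) (a<b : a < b) (b<c : b < c)
         (p : PreservesRelations a b c a′ b′ c′) where
  open PreservesRelations p

  private
    a<c : a < c
    a<c = <-trans a<b b<c
    1≤b : 1 ≤ b
    1≤b = <⇒≤ (≤-<-trans 1≤a a<b)
    1≤c : 1 ≤ c
    1≤c = <⇒≤ (<-trans (≤-<-trans 1≤a a<b) b<c)
    b≢1 : b ≢ 1
    b≢1 = >⇒≢ (≤-<-trans 1≤a a<b)
    c≢1 : c ≢ 1
    c≢1 = >⇒≢ (<-trans (≤-<-trans 1≤a a<b) b<c)
    m+1≡n⇒n≤o : ∀ {m n o} → m < o → m + 1 ≡ n → n ≤ o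
    m+1≡n⇒n≤o {m} {o = o} m<o e = subst (_≤ o) (trans (+-comm 1 m) e) m<o

  triple-⊑ : triple a b c ⊑ triple a′ b′ c′
  triple-⊑ (addOne 0F 0F) e = ⊥-elim (m≤n⇒n+1≢m ≤-refl e)
  triple-⊑ (addOne 0F 1F) e = suc-ab e
  triple-⊑ (addOne 0F 2F) e = ⊥-elim (<⇒≱ b<c (m+1≡n⇒n≤o a<b e))
  triple-⊑ (addOne 1F 0F) e = ⊥-elim (m≤n⇒n+1≢m (<⇒≤ a<b) e)
  triple-⊑ (addOne 1F 1F) e = ⊥-elim (m≤n⇒n+1≢m ≤-refl e)
  triple-⊑ (addOne 1F 2F) e = suc-bc e
  triple-⊑ (addOne 2F 0F) e = ⊥-elim (m≤n⇒n+1≢m (<⇒≤ a<c) e)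
  triple-⊑ (addOne 2F 1F) e = ⊥-elim (m≤n⇒n+1≢m (<⇒≤ b<c) e)
  triple-⊑ (addOne 2F 2F) e = ⊥-elim (m≤n⇒n+1≢m ≤-refl e)
  triple-⊑ (mul 0F 0F 0F) e rewrite unit (m*n≡n⇒m≡1 1≤a e) = refl
  triple-⊑ (mul 0F 0F 1F) e = sq-ab e
  triple-⊑ (mul 0F 0F 2F) e = sq-ac e
  triple-⊑ (mul 0F 1F 0F) e = ⊥-elim (b≢1 (m*n≡m⇒n≡1 1≤a e))
  triple-⊑ (mul 0F 1F 1F) e rewrite unit (m*n≡n⇒m≡1 1≤b e) = *-identityˡ b′
  triple-⊑ (mul 0F 1F 2F) e = mul-abc e
  triple-⊑ (mul 0F 2F 0F) e = ⊥-elim (c≢1 (m*n≡m⇒n≡1 1≤a e))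
  triple-⊑ (mul 0F 2F 1F) e = ⊥-elim (o<n⇒m*n≢o 1≤a b<c e)
  triple-⊑ (mul 0F 2F 2F) e rewrite unit (m*n≡n⇒m≡1 1≤c e) = *-identityˡ c′
  triple-⊑ (mul 1F 0F 0F) e = ⊥-elim (b≢1 (m*n≡n⇒m≡1 1≤a e))
  triple-⊑ (mul 1F 0F 1F) e rewrite unit (m*n≡m⇒n≡1 1≤b e) = *-identityʳ b′
  triple-⊑ (mul 1F 0F 2F) e = trans (*-comm b′ a′) (mul-abc (trans (*-comm a b) e))
  triple-⊑ (mul 1F 1F 0F) e = ⊥-elim (o<n⇒m*n≢o 1≤b a<b e)
  triple-⊑ (mul 1F 1F 1F) e = ⊥-elim (b≢1 (m*n≡n⇒m≡1 1≤b e))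
  triple-⊑ (mul 1F 1F 2F) e = sq-bc e
  triple-⊑ (mul 1F 2F 0F) e = ⊥-elim (o<n⇒m*n≢o 1≤b a<c e)
  triple-⊑ (mul 1F 2F 1F) e = ⊥-elim (o<n⇒m*n≢o 1≤b b<c e)
  triple-⊑ (mul 1F 2F 2F) e = ⊥-elim (b≢1 (m*n≡n⇒m≡1 1≤c e))
  triple-⊑ (mul 2F 0F 0F) e = ⊥-elim (c≢1 (m*n≡n⇒m≡1 1≤a e))
  triple-⊑ (mul 2F 0F 1F) e = ⊥-elim (o<m⇒m*n≢o 1≤a b<c e)
  triple-⊑ (mul 2F 0F 2F) e rewrite unit (m*n≡m⇒n≡1 1≤c e) = *-identityʳ c′
  triple-⊑ (mul 2F 1F 0F) e = ⊥-elim (o<m⇒m*n≢o 1≤b a<c e)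
  triple-⊑ (mul 2F 1F 1F) e = ⊥-elim (o<m⇒m*n≢o 1≤b b<c e)
  triple-⊑ (mul 2F 1F 2F) e = ⊥-elim (b≢1 (m*n≡m⇒n≡1 1≤c e))
  triple-⊑ (mul 2F 2F 0F) e = ⊥-elim (o<m⇒m*n≢o 1≤c a<c e)
  triple-⊑ (mul 2F 2F 1F) e = ⊥-elim (o<m⇒m*n≢o 1≤c b<c e)
  triple-⊑ (mul 2F 2F 2F) e = ⊥-elim (c≢1 (m*n≡n⇒m≡1 1≤c e))

pair : ℕ → ℕ → Assignment 2
pair a b 0F = a
pair a b 1F = b

record IncreasingPair (x : Assignment 2) : Set where
  field
    a b : ℕ
    1≤a : 1 ≤ a
    a<b : a < b
    σ   : Fin 2 → Fin 2
    x≗  : x ≗ pair a b ∘ σ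

-- When x takes fewer than three values, the triple is padded with values x does not take.
record IncreasingTriple (x : Assignment 3) : Set where
  field
    a b c : ℕ
    1≤a   : 1 ≤ a
    a<b   : a < b
    b<c   : b < c
    σ     : Fin 3 → Fin 3
    x≗    : x ≗ triple a b c ∘ σ

increasing-pair : (x : Assignment 2) → (∀ i → 1 ≤ x i) → IncreasingPair x
increasing-pair x pos with <-cmp (x 0F) (x 1F)
... | tri< x₀<x₁ _ _ = record
  { a = x 0F ; b = x 1F ; 1≤a = pos 0F ; a<b = x₀<x₁ ; σ = id ; x≗ = λ { 0F → refl ; 1F → refl } }
... | tri≈ _ x₀≡x₁ _ = record
  { a = x 0F ; b = suc (x 0F) ; 1≤a = pos 0F ; a<b = n<1+n (x 0F) ; σ = λ _ → 0F
  ; x≗ = λ { 0F → refl ; 1F → sym x₀≡x₁ } }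
... | tri> _ _ x₁<x₀ = record
  { a = x 1F ; b = x 0F ; 1≤a = pos 1F ; a<b = x₁<x₀ ; σ = λ { 0F → 1F ; 1F → 0F }
  ; x≗ = λ { 0F → refl ; 1F → refl } }

module _ (x : Assignment 3) (P : IncreasingPair (x ∘ inject₁)) where
  open IncreasingPair P

  private
    extend : ∀ {a′ b′ c′} → 1 ≤ a′ → a′ < b′ → b′ < c′ → (τ : Fin 2 → Fin 3) (k : Fin 3) →
             pair a b ≗ triple a′ b′ c′ ∘ τ → x 2F ≡ triple a′ b′ c′ k → IncreasingTriple x
    extend {a′} {b′} {c′} 1≤a′ a′<b′ b′<c′ τ k pair≗ x₂≡ = record
      { a = a′ ; b = b′ ; c = c′ ; 1≤a = 1≤a′ ; a<b = a′<b′ ; b<c = b′<c′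
      ; σ = λ { 0F → τ (σ 0F) ; 1F → τ (σ 1F) ; 2F → k }
      ; x≗ = λ { 0F → trans (x≗ 0F) (pair≗ (σ 0F)) ; 1F → trans (x≗ 1F) (pair≗ (σ 1F)) ; 2F → x₂≡ } }

  insert : 1 ≤ x 2F → IncreasingTriple x
  insert 1≤w with <-cmp (x 2F) a | <-cmp (x 2F) b
  ... | tri< w<a _ _ | _ = extend 1≤w w<a a<b (λ { 0F → 1F ; 1F → 2F }) 0F (λ { 0F → refl ; 1F → refl }) refl
  ... | tri≈ _ w≡a _ | _ = extend 1≤a a<b (n<1+n b) inject₁ 0F (λ { 0F → refl ; 1F → refl }) w≡a
  ... | tri> _ _ a<w | tri< w<b _ _ =
    extend 1≤a a<w w<b (λ { 0F → 0F ; 1F → 2F }) 1F (λ { 0F → refl ; 1F → refl }) refl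
  ... | tri> _ _ _ | tri≈ _ w≡b _ = extend 1≤a a<b (n<1+n b) inject₁ 1F (λ { 0F → refl ; 1F → refl }) w≡b
  ... | tri> _ _ _ | tri> _ _ b<w = extend 1≤a a<b b<w inject₁ 2F (λ { 0F → refl ; 1F → refl }) refl

increasing-triple : (x : Assignment 3) → (∀ i → 1 ≤ x i) → IncreasingTriple x
increasing-triple x pos = insert x (increasing-pair (x ∘ inject₁) (pos ∘ inject₁)) (pos 2F)

triple≤c : ∀ {a b c} → a < b → b < c → ∀ k → triple a b c k ≤ c
triple≤c a<b b<c 0F = <⇒≤ (<-trans a<b b<c)
triple≤c a<b b<c 1F = <⇒≤ b<c
triple≤c a<b b<c 2F = ≤-refl

record TopLift (a b c a′ b′ N : ℕ) : Set where
  field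
    c′      : ℕ
    suc-bc  : b + 1 ≡ c → b′ + 1 ≡ c′
    sq-ac   : a * a ≡ c → a′ * a′ ≡ c′
    mul-abc : a * b ≡ c → a′ * b′ ≡ c′
    sq-bc   : b * b ≡ c → b′ * b′ ≡ c′
    N≤c′    : N ≤ c′

-- The bridge anticipates c = b + 1 = a², as in (3, 8, 9), which forces b′ = N² ∸ 1.
record MiddleLift (a b c N : ℕ) : Set where
  field
    b′     : ℕ
    suc-ab : a + 1 ≡ b → N + 1 ≡ b′
    sq-ab  : a * a ≡ b → N * N ≡ b′
    bridge : b + 1 ≡ c → a * a ≡ c → b′ + 1 ≡ N * N
    N≤b′   : N ≤ b′

record LargeLift (a b c t : ℕ) : Set where
  field
    a′ b′ c′  : ℕ
    preserves : PreservesRelations a b c a′ b′ c′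
    positive  : ∀ i → 1 ≤ triple a′ b′ c′ i
    large     : ∀ i → 5 ≤ triple a b c i → t ≤ triple a′ b′ c′ i

module _ {b c} (1<b : 1 < b) (b<c : b < c) where
  private
    1≢c : 1 ≢ c
    1≢c = <⇒≢ (<-trans 1<b b<c)
    1*b≢c : 1 * b ≢ c
    1*b≢c = <⇒≢ (≤-<-trans (≤-reflexive (*-identityˡ b)) b<c)

  top-lift-a≡1 : ∀ b′ N → 1 ≤ N → N ≤ b′ → TopLift 1 b c 1 b′ N
  top-lift-a≡1 b′ N 1≤N N≤b′ with b + 1 ≟ c | b * b ≟ c
  ... | yes b+1≡c | _ = record
    { c′ = b′ + 1 ; suc-bc = λ _ → refl ; sq-ac = ⊥-elim ∘ 1≢c ; mul-abc = ⊥-elim ∘ 1*b≢c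
    ; sq-bc = λ b*b≡c → ⊥-elim (>⇒≢ (n+1<m*n 1<b 1<b) (trans b*b≡c (sym b+1≡c)))
    ; N≤c′ = m≤n⇒m≤n+o 1 N≤b′ }
  ... | no b+1≢c | yes _ = record
    { c′ = b′ * b′ ; suc-bc = ⊥-elim ∘ b+1≢c ; sq-ac = ⊥-elim ∘ 1≢c ; mul-abc = ⊥-elim ∘ 1*b≢c
    ; sq-bc = λ _ → refl
    ; N≤c′ = ≤-trans N≤b′ (m≤m*n b′ b′ {{>-nonZero (≤-trans 1≤N N≤b′)}}) }
  ... | no b+1≢c | no b*b≢c = record
    { c′ = N ; suc-bc = ⊥-elim ∘ b+1≢c ; sq-ac = ⊥-elim ∘ 1≢c ; mul-abc = ⊥-elim ∘ 1*b≢c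
    ; sq-bc = ⊥-elim ∘ b*b≢c ; N≤c′ = ≤-refl }

  lift-a≡1 : 5 ≤ c → ∀ t → LargeLift 1 b c t
  -- Exposing c = 5 + k lets absurd patterns refute the equations 3 = c, 4 = c, … below.
  lift-a≡1 (s≤s (s≤s (s≤s (s≤s (s≤s _))))) t with b ≟ 2
  ... | yes refl = record
    { a′ = 1 ; b′ = 2 ; c′ = suc t
    ; preserves = record
      { unit = λ _ → refl ; suc-ab = λ _ → refl ; suc-bc = λ () ; sq-ab = λ ()
      ; sq-ac = λ () ; mul-abc = λ () ; sq-bc = λ () }
    ; positive = λ { 0F → ≤-refl ; 1F → s≤s z≤n ; 2F → s≤s z≤n }
    ; large = λ { 0F (s≤s ()) ; 1F (s≤s (s≤s ())) ; 2F _ → n≤1+n t } }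
  ... | no b≢2 = record
    { a′ = 1 ; b′ = suc t ; c′ = c′
    ; preserves = record
      { unit = λ _ → refl ; suc-ab = ⊥-elim ∘ b≢2 ∘ sym ; suc-bc = suc-bc
      ; sq-ab = ⊥-elim ∘ <⇒≢ 1<b ; sq-ac = sq-ac ; mul-abc = mul-abc ; sq-bc = sq-bc }
    ; positive = λ { 0F → ≤-refl ; 1F → s≤s z≤n ; 2F → ≤-trans (s≤s z≤n) N≤c′ }
    ; large = λ { 0F (s≤s ()) ; 1F _ → n≤1+n t ; 2F _ → ≤-trans (n≤1+n t) N≤c′ } }
    where open TopLift (top-lift-a≡1 (suc t) (suc t) (s≤s z≤n) ≤-refl)

module _ {a b c} (2≤a : 2 ≤ a) (a<b : a < b) (b<c : b < c) where
  private
    instance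
      a≢0 : NonZero a
      a≢0 = >-nonZero (<⇒≤ 2≤a)
      b≢0 : NonZero b
      b≢0 = >-nonZero (<-trans (<⇒≤ 2≤a) a<b)
    2≤b : 2 ≤ b
    2≤b = ≤-trans 2≤a (<⇒≤ a<b)

  module _ {N} (2≤N : 2 ≤ N) where
    private
      instance
        N≢0 : NonZero N
        N≢0 = >-nonZero (<⇒≤ 2≤N)

    middle-lift-2≤a : 5 ≤ c → MiddleLift a b c N
    middle-lift-2≤a 5≤c with a + 1 ≟ b | a * a ≟ b | a * a ≟ b + 1
    ... | yes a+1≡b | _ | _ = record
      { b′ = N + 1 ; suc-ab = λ _ → refl
      ; sq-ab = λ a*a≡b → ⊥-elim (>⇒≢ (n+1<m*n 2≤a 2≤a) (trans a*a≡b (sym a+1≡b)))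
      ; bridge = λ b+1≡c a*a≡c →
          -- c = a + 2 = a² forces (a, b, c) = (2, 3, 4)
          let c≡a+1+1 = trans (sym b+1≡c) (cong (_+ 1) (sym a+1≡b))
              a≡2     = m*m≡m+1+1⇒m≡2 a (trans a*a≡c c≡a+1+1)
          in  ⊥-elim (<-irrefl refl (subst (λ m → 5 ≤ m + 1 + 1) a≡2 (subst (5 ≤_) c≡a+1+1 5≤c)))
      ; N≤b′ = m≤m+n N 1 }
    ... | no a+1≢b | yes a*a≡b | _ = record
      { b′ = N * N ; suc-ab = ⊥-elim ∘ a+1≢b ; sq-ab = λ _ → refl
      ; bridge = λ b+1≡c a*a≡c → ⊥-elim (m≤n⇒n+1≢m ≤-refl (trans b+1≡c (trans (sym a*a≡c) a*a≡b)))
      ; N≤b′ = m≤m*n N N }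
    ... | no a+1≢b | no a*a≢b | yes a*a≡b+1 = record
      { b′ = N * N ∸ 1 ; suc-ab = ⊥-elim ∘ a+1≢b ; sq-ab = ⊥-elim ∘ a*a≢b
      ; bridge = λ _ _ → m∸n+n≡m (≤-trans (<⇒≤ 2≤N) (m≤m*n N N))
      ; N≤b′ = m+n≤o⇒m≤o∸n N (<⇒≤ (n+1<m*n 2≤N 2≤N)) }
    ... | no a+1≢b | no a*a≢b | no a*a≢b+1 = record
      { b′ = N ; suc-ab = ⊥-elim ∘ a+1≢b ; sq-ab = ⊥-elim ∘ a*a≢b
      ; bridge = λ b+1≡c a*a≡c → ⊥-elim (a*a≢b+1 (trans a*a≡c (sym b+1≡c)))
      ; N≤b′ = ≤-refl }

    top-lift-2≤a : ∀ b′ → N ≤ b′ → (b + 1 ≡ c → a * a ≡ c → b′ + 1 ≡ N * N) → TopLift a b c N b′ N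
    top-lift-2≤a b′ N≤b′ bridge with b + 1 ≟ c | a * a ≟ c | a * b ≟ c | b * b ≟ c
    ... | yes b+1≡c | _ | _ | _ = record
      { c′ = b′ + 1 ; suc-bc = λ _ → refl ; sq-ac = sym ∘ bridge b+1≡c
      ; mul-abc = λ a*b≡c → ⊥-elim (>⇒≢ (n+1<m*n 2≤a 2≤b) (trans a*b≡c (sym b+1≡c)))
      ; sq-bc = λ b*b≡c → ⊥-elim (>⇒≢ (n+1<m*n 2≤b 2≤b) (trans b*b≡c (sym b+1≡c)))
      ; N≤c′ = m≤n⇒m≤n+o 1 N≤b′ }
    ... | no b+1≢c | yes a*a≡c | _ | _ = record
      { c′ = N * N ; suc-bc = ⊥-elim ∘ b+1≢c ; sq-ac = λ _ → refl
      ; mul-abc = λ a*b≡c → ⊥-elim (>⇒≢ (*-monoʳ-< a a<b) (trans a*b≡c (sym a*a≡c)))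
      ; sq-bc = λ b*b≡c → ⊥-elim (>⇒≢ (*-mono-< a<b a<b) (trans b*b≡c (sym a*a≡c)))
      ; N≤c′ = m≤m*n N N }
    ... | no b+1≢c | no a*a≢c | yes a*b≡c | _ = record
      { c′ = N * b′ ; suc-bc = ⊥-elim ∘ b+1≢c ; sq-ac = ⊥-elim ∘ a*a≢c ; mul-abc = λ _ → refl
      ; sq-bc = λ b*b≡c → ⊥-elim (>⇒≢ (*-monoˡ-< b a<b) (trans b*b≡c (sym a*b≡c)))
      ; N≤c′ = m≤m*n N b′ {{>-nonZero (≤-trans (<⇒≤ 2≤N) N≤b′)}} }
    ... | no b+1≢c | no a*a≢c | no a*b≢c | yes _ = record
      { c′ = b′ * b′ ; suc-bc = ⊥-elim ∘ b+1≢c ; sq-ac = ⊥-elim ∘ a*a≢c ; mul-abc = ⊥-elim ∘ a*b≢c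
      ; sq-bc = λ _ → refl
      ; N≤c′ = ≤-trans N≤b′ (m≤m*n b′ b′ {{>-nonZero (≤-trans (<⇒≤ 2≤N) N≤b′)}}) }
    ... | no b+1≢c | no a*a≢c | no a*b≢c | no b*b≢c = record
      { c′ = N ; suc-bc = ⊥-elim ∘ b+1≢c ; sq-ac = ⊥-elim ∘ a*a≢c ; mul-abc = ⊥-elim ∘ a*b≢c
      ; sq-bc = ⊥-elim ∘ b*b≢c ; N≤c′ = ≤-refl }

  lift-2≤a : 5 ≤ c → ∀ t → LargeLift a b c t
  lift-2≤a 5≤c t = record
    { a′ = N ; b′ = b′ ; c′ = c′
    ; preserves = record
      { unit = ⊥-elim ∘ >⇒≢ 2≤a ; suc-ab = suc-ab ; suc-bc = suc-bc ; sq-ab = sq-ab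
      ; sq-ac = sq-ac ; mul-abc = mul-abc ; sq-bc = sq-bc }
    ; positive = λ i → ≤-trans (s≤s z≤n) (N≤ i)
    ; large = λ i _ → ≤-trans (m≤n+m t 2) (N≤ i) }
    where
      N = 2 + t
      2≤N : 2 ≤ N
      2≤N = s≤s (s≤s z≤n)
      open MiddleLift (middle-lift-2≤a 2≤N 5≤c)
      open TopLift (top-lift-2≤a 2≤N b′ N≤b′ bridge)
      N≤ : ∀ i → N ≤ triple N b′ c′ i
      N≤ 0F = ≤-refl
      N≤ 1F = N≤b′
      N≤ 2F = N≤c′

lift : ∀ {a b c} → 1 ≤ a → a < b → b < c → 5 ≤ c → ∀ t → LargeLift a b c t
lift {a} 1≤a a<b b<c with a ≟ 1
... | yes refl = lift-a≡1 a<b b<c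
... | no a≢1 = lift-2≤a (≤∧≢⇒< 1≤a (a≢1 ∘ sym)) a<b b<c

large-solutions : ∀ {T : System 3} {x} → PosSolution T x → ∀ i → 5 ≤ x i →
                  ∀ t → ∃[ y ] PosSolution T y × t ≤ y i
large-solutions {x = x} sol@(pos , _) i 5≤xᵢ t =
  triple a′ b′ c′ ∘ σ , ⊑-PosSolution x⊑y (positive ∘ σ) sol , large (σ i) 5≤v
  where
    open IncreasingTriple (increasing-triple x pos)
    5≤v : 5 ≤ triple a b c (σ i)
    5≤v = subst (5 ≤_) (x≗ i) 5≤xᵢ
    open LargeLift (lift 1≤a a<b b<c (≤-trans 5≤v (triple≤c a<b b<c (σ i))) t)
    x⊑y : x ⊑ triple a′ b′ c′ ∘ σ
    x⊑y = ⊑-trans (≗⇒⊑ x≗) (∘-⊑ σ (triple-⊑ 1≤a a<b b<c preserves))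

listed⇒≤max : ∀ {n} {x : Assignment n} {L : List (Assignment n)} i →
              Any (λ y → ∀ j → x j ≡ y j) L → x i ≤ max 0 (map (λ y → y i) L)
listed⇒≤max i x∈L = v≤max⁺ 0 _ (inj₂ (map⁺ (Any.map (λ x≗y → ≤-reflexive (x≗y i)) x∈L)))

theorem9 : (T : System 3) → FinitelyManyPosSolutions T →
    ∀ (x : Assignment 3) → PosSolution T x → ∀ (i : Fin 3) → x i ≤ 4
theorem9 T (L , finite) x sol i = ≮⇒≥ λ 4<xᵢ →
  let (y , y-sol , B<yᵢ) = large-solutions sol i 4<xᵢ (suc B)
  in <⇒≱ B<yᵢ (listed⇒≤max i (finite y y-sol))
  where
    B = max 0 (map (λ y → y i) L)
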